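{- If $\vec T$ satisfies Condition 1 or Condition 3 at every vertex of $H$, then $K$ has at most two connected components.
   Context: $H$ is a connected finite simple graph with no leaves, vertices $1,\dots,t$, $k$ edges, oriented arbitrarily with directed edges $\overrightarrow{a_1a_2},\dots,\overrightarrow{a_{2k-1}a_{2k}}$; $\Gamma(b)=\{i:a_i=b\}$. $G$ is a finite simple graph and $\vec G$ its symmetric digraph. $\vec T=(\vec T_1,\vec T_2)$ is a $2k$-tuple of edges of $\vec G$ with $\vec T_1=(\overrightarrow{v_1v_2},\dots,\overrightarrow{v_{2k-1}v_{2k}})$, $\vec T_2=(\overrightarrow{w_1w_2},\dots,\overrightarrow{w_{2k-1}w_{2k}})$. $K$ is the undirected subgraph of $G$ consisting of the edges $v_{2i-1}v_{2i}$ and $w_{2i-1}w_{2i}$. Conditions at a vertex $b$ of $H$: Condition 1: the $v_i$, $i\in\Gamma(b)$, are all equal and the $w_i$, $i\in\Gamma(b)$, are all equal. Condition 3: there are vertices $x,y$ of $G$ such that for every $i\in\Gamma(b)$, either ($v_i=x$, $w_i=y$) or ($v_i=y$, $w_i=x$). -}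

module Defs where

open import Data.Nat using (ℕ)
open import Data.Fin using (Fin)
open import Data.Product using (Σ; ∃; _×_; _,_)
open import Data.Sum using (_⊎_)
open import Relation.Nullary using (¬_)
open import Relation.Binary.PropositionalEquality using (_≡_; _≢_)
open import Relation.Binary.Construct.Closure.ReflexiveTransitive using (Star)

-- Endpoint of a directed edge: tail (odd index 2i-1) or head (even index 2i).
data End : Set where
  tl hd : End

-- Positions 1..2k of a 2k-tuple, indexed as (edge i, endpoint):
-- (i , tl) ↔ 2i-1 and (i , hd) ↔ 2i.
Pos : ℕ → Set
Pos k = Fin k × End

-- The graph H : vertices Fin t, k edges, oriented; edge i is a_{2i-1} → a_{2i},
-- given by  a : Pos k → Fin t.

InΓ : ∀ {t k} → (Pos k → Fin t) → Fin t → Pos k → Set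
InΓ a b p = a p ≡ b

HAdj : ∀ {t k} → (Pos k → Fin t) → Fin t → Fin t → Set
HAdj {k = k} a b c = Σ (Fin k) λ i →
  (a (i , tl) ≡ b × a (i , hd) ≡ c) ⊎ (a (i , hd) ≡ b × a (i , tl) ≡ c)

HSimple : ∀ {t k} → (Pos k → Fin t) → Set
HSimple {k = k} a =
  (∀ i → a (i , tl) ≢ a (i , hd)) ×
  (∀ i j → HAdj′ i j → i ≡ j)
  where
  HAdj′ : Fin k → Fin k → Set
  HAdj′ i j = (a (i , tl) ≡ a (j , tl) × a (i , hd) ≡ a (j , hd))
            ⊎ (a (i , tl) ≡ a (j , hd) × a (i , hd) ≡ a (j , tl))

HConnected : ∀ {t k} → (Pos k → Fin t) → Set
HConnected a = ∀ b c → Star (HAdj a) b c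

IsLeaf : ∀ {t k} → (Pos k → Fin t) → Fin t → Set
IsLeaf a b = Σ _ λ p → InΓ a b p × (∀ q → InΓ a b q → q ≡ p)

NoLeaves : ∀ {t k} → (Pos k → Fin t) → Set
NoLeaves a = ∀ b → ¬ IsLeaf a b

record SimpleGraph (n : ℕ) : Set₁ where
  field
    Adj     : Fin n → Fin n → Set
    sym     : ∀ {x y} → Adj x y → Adj y x
    irrefl  : ∀ {x} → ¬ Adj x x

open SimpleGraph public

IsEdgeTuple : ∀ {n k} → SimpleGraph n → (Pos k → Fin n) → Set
IsEdgeTuple {k = k} G v = ∀ (i : Fin k) → Adj G (v (i , tl)) (v (i , hd))

-- The undirected subgraph K of G with edges v_{2i-1}v_{2i} and w_{2i-1}w_{2i}

KVertex : ∀ {n k} → (Pos k → Fin n) → (Pos k → Fin n) → Fin n → Set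
KVertex v w x = Σ _ λ p → (v p ≡ x) ⊎ (w p ≡ x)

KAdj : ∀ {n k} → (Pos k → Fin n) → (Pos k → Fin n) → Fin n → Fin n → Set
KAdj {k = k} v w x y = Σ (Fin k) λ i →
    (v (i , tl) ≡ x × v (i , hd) ≡ y) ⊎ (v (i , hd) ≡ x × v (i , tl) ≡ y)
  ⊎ ((w (i , tl) ≡ x × w (i , hd) ≡ y) ⊎ (w (i , hd) ≡ x × w (i , tl) ≡ y))

KConn : ∀ {n k} → (Pos k → Fin n) → (Pos k → Fin n) → Fin n → Fin n → Set
KConn v w = Star (KAdj v w)

-- K has at most two connected components: among any three vertices of K,
-- some two lie in the same component.
AtMostTwoComponents : ∀ {n k} → (Pos k → Fin n) → (Pos k → Fin n) → Set
AtMostTwoComponents v w = ∀ x y z → KVertex v w x → KVertex v w y → KVertex v w z →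
  KConn v w x y ⊎ KConn v w x z ⊎ KConn v w y z

Condition1 : ∀ {t n k} → (Pos k → Fin t) → (Pos k → Fin n) → (Pos k → Fin n) → Fin t → Set
Condition1 a v w b =
  (∀ p q → InΓ a b p → InΓ a b q → v p ≡ v q) ×
  (∀ p q → InΓ a b p → InΓ a b q → w p ≡ w q)

Condition3 : ∀ {t n k} → (Pos k → Fin t) → (Pos k → Fin n) → (Pos k → Fin n) → Fin t → Set
Condition3 {n = n} a v w b = Σ (Fin n) λ x → Σ (Fin n) λ y →
  ∀ p → InΓ a b p → (v p ≡ x × w p ≡ y) ⊎ (v p ≡ y × w p ≡ x)

-- Fix a position p₀ and put r₁ = v p₀, r₂ = w p₀. Call a position p anchored
-- when v p and w p are joined in K to r₁ and r₂, in one order or the other.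
-- Both conditions say that the positions of Γ(b) all carry the same unordered
-- pair {v, w}, so anchoring is shared by all positions at a vertex of H, and
-- the K-edges v₂ᵢ₋₁v₂ᵢ, w₂ᵢ₋₁w₂ᵢ carry it across each edge of H. As H is
-- connected, every position is anchored, so every vertex of K lies in the
-- component of r₁ or of r₂.
module Submission where

open import Defs
open import Data.Nat using (ℕ)
open import Data.Fin using (Fin)
open import Data.Sum using (_⊎_; inj₁; inj₂)
open import Data.Product using (_×_; _,_)
open import Relation.Binary.Core using (Rel)
open import Relation.Binary.Definitions using (Symmetric)
open import Relation.Binary.PropositionalEquality using (_≡_; refl; trans) renaming (sym to ≡-sym)
open import Relation.Binary.Construct.Closure.ReflexiveTransitive using (Star; ε; _◅_; _◅◅_; reverse)

opposite : End → End
opposite tl = hd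
opposite hd = tl

module _ {a ℓ} {A : Set a} {R : Rel A ℓ} (sym : Symmetric R) {r₁ r₂ : A} where

  private
    join : ∀ {s t r} → Star R s r → Star R t r → Star R s t
    join s↝r t↝r = s↝r ◅◅ reverse sym t↝r

  two-roots⇒two-of-three-connected : ∀ {x y z} →
    Star R x r₁ ⊎ Star R x r₂ → Star R y r₁ ⊎ Star R y r₂ → Star R z r₁ ⊎ Star R z r₂ →
    Star R x y ⊎ Star R x z ⊎ Star R y z
  two-roots⇒two-of-three-connected (inj₁ x↝) (inj₁ y↝) _         = inj₁ (join x↝ y↝)
  two-roots⇒two-of-three-connected (inj₂ x↝) (inj₂ y↝) _         = inj₁ (join x↝ y↝)
  two-roots⇒two-of-three-connected (inj₁ x↝) (inj₂ _)  (inj₁ z↝) = inj₂ (inj₁ (join x↝ z↝))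
  two-roots⇒two-of-three-connected (inj₂ x↝) (inj₁ _)  (inj₂ z↝) = inj₂ (inj₁ (join x↝ z↝))
  two-roots⇒two-of-three-connected (inj₁ _)  (inj₂ y↝) (inj₂ z↝) = inj₂ (inj₂ (join y↝ z↝))
  two-roots⇒two-of-three-connected (inj₂ _)  (inj₁ y↝) (inj₁ z↝) = inj₂ (inj₂ (join y↝ z↝))

module _ {n k : ℕ} (v w : Pos k → Fin n) where

  KAdj-sym : Symmetric (KAdj v w)
  KAdj-sym (i , inj₁ (x≡ , y≡))               = i , inj₂ (inj₁ (y≡ , x≡))
  KAdj-sym (i , inj₂ (inj₁ (x≡ , y≡)))        = i , inj₁ (y≡ , x≡)
  KAdj-sym (i , inj₂ (inj₂ (inj₁ (x≡ , y≡)))) = i , inj₂ (inj₂ (inj₂ (y≡ , x≡)))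
  KAdj-sym (i , inj₂ (inj₂ (inj₂ (x≡ , y≡)))) = i , inj₂ (inj₂ (inj₁ (y≡ , x≡)))

  KAdj-v-opposite : ∀ i e → KAdj v w (v (i , opposite e)) (v (i , e))
  KAdj-v-opposite i tl = i , inj₂ (inj₁ (refl , refl))
  KAdj-v-opposite i hd = i , inj₁ (refl , refl)

  KAdj-w-opposite : ∀ i e → KAdj v w (w (i , opposite e)) (w (i , e))
  KAdj-w-opposite i tl = i , inj₂ (inj₂ (inj₂ (refl , refl)))
  KAdj-w-opposite i hd = i , inj₂ (inj₂ (inj₁ (refl , refl)))

  SameUnorderedPair : Pos k → Pos k → Set
  SameUnorderedPair p q = (v q ≡ v p × w q ≡ w p) ⊎ (v q ≡ w p × w q ≡ v p)

  conditions⇒SameUnorderedPair : ∀ {t} {a : Pos k → Fin t} {b p q} →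
    Condition1 a v w b ⊎ Condition3 a v w b → InΓ a b p → InΓ a b q → SameUnorderedPair p q
  conditions⇒SameUnorderedPair (inj₁ (v-const , w-const)) p∈ q∈ =
    inj₁ (v-const _ _ q∈ p∈ , w-const _ _ q∈ p∈)
  conditions⇒SameUnorderedPair {p = p} {q} (inj₂ (x , y , xy-or-yx)) p∈ q∈
    with xy-or-yx p p∈ | xy-or-yx q q∈
  ... | inj₁ (vp≡x , wp≡y) | inj₁ (vq≡x , wq≡y) = inj₁ (trans vq≡x (≡-sym vp≡x) , trans wq≡y (≡-sym wp≡y))
  ... | inj₁ (vp≡x , wp≡y) | inj₂ (vq≡y , wq≡x) = inj₂ (trans vq≡y (≡-sym wp≡y) , trans wq≡x (≡-sym vp≡x))
  ... | inj₂ (vp≡y , wp≡x) | inj₁ (vq≡x , wq≡y) = inj₂ (trans vq≡x (≡-sym wp≡x) , trans wq≡y (≡-sym vp≡y))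
  ... | inj₂ (vp≡y , wp≡x) | inj₂ (vq≡y , wq≡x) = inj₁ (trans vq≡y (≡-sym vp≡y) , trans wq≡x (≡-sym wp≡x))

  module Anchoring (r₁ r₂ : Fin n) where

    AnchoredPair : Fin n → Fin n → Set
    AnchoredPair x y = (KConn v w x r₁ × KConn v w y r₂) ⊎ (KConn v w x r₂ × KConn v w y r₁)

    AnchoredPair-swap : ∀ {x y} → AnchoredPair x y → AnchoredPair y x
    AnchoredPair-swap (inj₁ (x↝ , y↝)) = inj₂ (y↝ , x↝)
    AnchoredPair-swap (inj₂ (x↝ , y↝)) = inj₁ (y↝ , x↝)

    AnchoredPair-extend : ∀ {x y x′ y′} → KConn v w x′ x → KConn v w y′ y →
                          AnchoredPair x y → AnchoredPair x′ y′
    AnchoredPair-extend x′↝x y′↝y (inj₁ (x↝ , y↝)) = inj₁ (x′↝x ◅◅ x↝ , y′↝y ◅◅ y↝)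
    AnchoredPair-extend x′↝x y′↝y (inj₂ (x↝ , y↝)) = inj₂ (x′↝x ◅◅ x↝ , y′↝y ◅◅ y↝)

    AnchoredPair⇒reaches-root : ∀ {x y z} → AnchoredPair x y → x ≡ z ⊎ y ≡ z →
                                KConn v w z r₁ ⊎ KConn v w z r₂
    AnchoredPair⇒reaches-root (inj₁ (x↝ , _)) (inj₁ refl) = inj₁ x↝
    AnchoredPair⇒reaches-root (inj₁ (_ , y↝)) (inj₂ refl) = inj₂ y↝
    AnchoredPair⇒reaches-root (inj₂ (x↝ , _)) (inj₁ refl) = inj₂ x↝
    AnchoredPair⇒reaches-root (inj₂ (_ , y↝)) (inj₂ refl) = inj₁ y↝

    Anchored : Pos k → Set
    Anchored p = AnchoredPair (v p) (w p)

    Anchored-opposite : ∀ i e → Anchored (i , e) → Anchored (i , opposite e)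
    Anchored-opposite i e = AnchoredPair-extend (KAdj-v-opposite i e ◅ ε) (KAdj-w-opposite i e ◅ ε)

    Anchored-resp : ∀ {p q} → SameUnorderedPair p q → Anchored p → Anchored q
    Anchored-resp (inj₁ (vq≡vp , wq≡wp)) rewrite vq≡vp | wq≡wp = λ anchored → anchored
    Anchored-resp (inj₂ (vq≡wp , wq≡vp)) rewrite vq≡wp | wq≡vp = AnchoredPair-swap

    module _ {t : ℕ} {a : Pos k → Fin t}
             (conditions : ∀ b → Condition1 a v w b ⊎ Condition3 a v w b) where

      AnchoredAt : Fin t → Set
      AnchoredAt b = ∀ p → InΓ a b p → Anchored p

      AnchoredAt-from : ∀ {b p} → InΓ a b p → Anchored p → AnchoredAt b
      AnchoredAt-from {b} p∈ anchored q q∈ =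
        Anchored-resp (conditions⇒SameUnorderedPair (conditions b) p∈ q∈) anchored

      AnchoredAt-adjacent : ∀ {b c} → HAdj a b c → AnchoredAt b → AnchoredAt c
      AnchoredAt-adjacent (i , inj₁ (tl∈b , hd∈c)) at-b =
        AnchoredAt-from hd∈c (Anchored-opposite i tl (at-b _ tl∈b))
      AnchoredAt-adjacent (i , inj₂ (hd∈b , tl∈c)) at-b =
        AnchoredAt-from tl∈c (Anchored-opposite i hd (at-b _ hd∈b))

      AnchoredAt-path : ∀ {b c} → Star (HAdj a) b c → AnchoredAt b → AnchoredAt c
      AnchoredAt-path ε           = λ at-b → at-b
      AnchoredAt-path (b∼c ◅ c↝d) = λ at-b → AnchoredAt-path c↝d (AnchoredAt-adjacent b∼c at-b)

lemma3p11 : (t k n : ℕ) (a : Pos k → Fin t) →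
    HSimple a → HConnected a → NoLeaves a →
    (G : SimpleGraph n) (v w : Pos k → Fin n) →
    IsEdgeTuple G v → IsEdgeTuple G w →
    (∀ b → Condition1 a v w b ⊎ Condition3 a v w b) →
    AtMostTwoComponents v w
lemma3p11 t k n a _ connected _ _ v w _ _ conditions x y z (p₀ , x∈) (p , y∈) (q , z∈) =
  two-roots⇒two-of-three-connected (KAdj-sym v w)
    (reaches-root p₀ x∈) (reaches-root p y∈) (reaches-root q z∈)
  where
  open Anchoring v w (v p₀) (w p₀)

  every-position-anchored : ∀ p → Anchored p
  every-position-anchored p =
    AnchoredAt-path conditions (connected (a p₀) (a p))
      (AnchoredAt-from conditions refl (inj₁ (ε , ε))) p refl

  reaches-root : ∀ p {u} → v p ≡ u ⊎ w p ≡ u → KConn v w u (v p₀) ⊎ KConn v w u (w p₀)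
  reaches-root p = AnchoredPair⇒reaches-root (every-position-anchored p)
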